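{- Let $A=(a_1,\ldots,a_s)$, let $L=\operatorname{lcm}(a_1,\ldots,a_s)$, and let $n\geq sL^2$. Then the $A$-monoculture banana path on $n+1$ vertices has gonality $L$: $\operatorname{gon}(B_{A;n})=\operatorname{lcm}(a_1,\ldots,a_s)$.
   Context: For a sequence $A=(a_1,\ldots,a_s)$ of positive integers and $n\geq 0$, $B_{A;n}$ (an $A$-monoculture banana path) is the multigraph on vertices $v_0,\ldots,v_n$ where $v_{i-1}$ and $v_i$ are joined by $a_j$ parallel edges for the $j\in\{1,\ldots,s\}$ congruent to $i$ modulo $s$, and no other edges. $\operatorname{gon}$ denotes the divisorial gonality, the minimum degree of a divisor of positive rank in the chip-firing (Baker–Norine) divisor theory. -}

module Defs where

open import Data.Nat as ℕ using (ℕ; zero; suc; NonZero)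
open import Data.Nat.LCM using (lcm)
open import Data.Nat.DivMod using (_mod_)
open import Data.Fin using (Fin; toℕ)
open import Data.Integer as ℤ using (ℤ; +_)
open import Data.Product using (Σ; _×_; ∃)
open import Data.Bool using (if_then_else_)
open import Relation.Nullary.Decidable using (⌊_⌋)
open import Relation.Binary.PropositionalEquality using (_≡_)

sumFin : ∀ {m} → (Fin m → ℤ) → ℤ
sumFin {zero}  f = + 0
sumFin {suc m} f = f Data.Fin.zero ℤ.+ sumFin {m} (λ i → f (Data.Fin.suc i))

-- A finite multigraph on vertex set Fin m, given by its edge-multiplicity
-- function w u v = number of edges between u and v (loops irrelevant).
Multigraph : ℕ → Set
Multigraph m = Fin m → Fin m → ℕ

Divisor : ℕ → Set
Divisor m = Fin m → ℤ

deg : ∀ {m} → Divisor m → ℤ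
deg D = sumFin D

Effective : ∀ {m} → Divisor m → Set
Effective D = ∀ v → + 0 ℤ.≤ D v

-- Change in the divisor produced by the firing script f (vertex u fires f u times):
-- (Δ f)(v) = Σ_u w(v,u) (f u - f v)  ( = -(Laplacian · f)(v) ).
fire : ∀ {m} → Multigraph m → (Fin m → ℤ) → Divisor m
fire w f v = sumFin (λ u → (+ w v u) ℤ.* (f u ℤ.- f v))

_∼[_]_ : ∀ {m} → Divisor m → Multigraph m → Divisor m → Set
_∼[_]_ {m} D w D' = Σ (Fin m → ℤ) (λ f → ∀ v → D' v ≡ D v ℤ.+ fire w f v)

unit : ∀ {m} → Fin m → Divisor m
unit v u = if ⌊ v Data.Fin.≟ u ⌋ then + 1 else + 0

RankNonNeg : ∀ {m} → Multigraph m → Divisor m → Set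
RankNonNeg {m} w D = Σ (Divisor m) (λ E → Effective E × (D ∼[ w ] E))

-- r(D) ≥ 1 : r(D) ≥ 0 and for every vertex v, r(D - v) ≥ 0
-- (every effective divisor of degree 1 is a single chip on a vertex).
PositiveRank : ∀ {m} → Multigraph m → Divisor m → Set
PositiveRank w D = RankNonNeg w D × (∀ v → RankNonNeg w (λ u → D u ℤ.- unit v u))

GonalityIs : ∀ {m} → Multigraph m → ℕ → Set
GonalityIs {m} w k =
  Σ (Divisor m) (λ D → PositiveRank w D × deg D ≡ + k)
  × (∀ (D : Divisor m) → PositiveRank w D → + k ℤ.≤ deg D)

lcmSeq : ∀ {s} → (Fin s → ℕ) → ℕ
lcmSeq {zero}  a = 1
lcmSeq {suc s} a = lcm (a Data.Fin.zero) (lcmSeq (λ i → a (Data.Fin.suc i)))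

-- The edge v_k — v_{k+1} (k = 0..n-1, i.e. i = k+1 in the paper) has
-- multiplicity a_j with j ≡ k+1 (mod s); 0-indexed that is a (k mod s).
banana : (s : ℕ) .{{_ : NonZero s}} → (Fin s → ℕ) → (n : ℕ) → Multigraph (suc n)
banana s a n u v =
  if ⌊ toℕ v ℕ.≟ suc (toℕ u) ⌋ then a (toℕ u mod s)
  else (if ⌊ toℕ u ℕ.≟ suc (toℕ v) ⌋ then a (toℕ v mod s) else 0)

{-# OPTIONS --safe #-}
-- Chip-firing on a path is governed by prefix sums: firing changes the number of chips on
-- v₀, …, vₖ by a multiple of the multiplicity c k of the edge vₖvₖ₊₁ and keeps the degree, and
-- conversely every such change is realised by a firing script.  As every edge multiplicity divides
-- L, the L chips on v₀ can be moved to any vertex, so gon ≤ L.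
--
-- Conversely let D have positive rank and degree d < L, and D ∼ E₀ ≥ 0 with prefix sums p.  As p is
-- nondecreasing with values in [0, d] and n ≥ sL², it is constant, say c, on a window
-- [b, b + 1 + d(s−1)].  Let D − v ∼ E ≥ 0 for v = v_{b + c(s−1) + 1}; the prefix sums q of E + v are
-- congruent to p modulo each edge multiplicity.  If q does not grow over s − 1 steps inside the
-- window, it is constant across edges of all s residues, so q ≡ c modulo every aᵢ, hence modulo L,
-- and q = c as both are at most d < L.  Climbing in steps of s − 1 from b, q therefore reaches c just
-- before v; descending from the end of the window, q ≤ c at v.  This contradicts the chip on v.

module Submission where

open import Defs
open import Data.Nat using (ℕ; NonZero; _≤_; _*_; _^_)
open import Data.Fin using (Fin)

open import Data.Nat as ℕ using (zero; suc; pred; _+_; _∸_; _<_; _≤′_; z≤n; s≤s; z<s; s<s; _≟_; _<?_; ∣_-_∣)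
open import Data.Nat.Properties
open import Data.Nat.Divisibility using (_∣_; divides; quotient; ∣-trans; 1∣_; m∣m*n; >⇒∤; _∣0)
open import Data.Nat.LCM using (lcm; lcm-least; m∣lcm[m,n]; n∣lcm[m,n]; gcd*lcm)
open import Data.Nat.GCD using (gcd)
open import Data.Nat.DivMod using (_mod_; _%_; m<n⇒m%n≡m; [m+n]%n≡m%n)
import Data.Nat.Tactic.RingSolver as ℕ-Ring
open import Data.Fin as F using (toℕ; fromℕ<)
open import Data.Fin.Properties
  using (toℕ-fromℕ<; toℕ-injective; toℕ<n; toℕ≤pred[n]; toℕ-inject₁; toℕ-fromℕ)
open import Data.Integer as ℤ using (ℤ; +_; _⊖_)
import Data.Integer.Properties as ℤP
import Data.Integer.Tactic.RingSolver as ℤ-Ring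
open import Algebra.Properties.AbelianGroup ℤP.+-0-abelianGroup using (∙-cancelˡ)
open import Algebra.Properties.CommutativeMonoid.Sum ℤP.+-0-commutativeMonoid
  using (sum; sum-cong-≗; ∑-distrib-+; sum-replicate-zero; sum-init-last)
open import Data.Product using (_×_; _,_; proj₁; proj₂; ∃-syntax)
open import Data.Sum using (_⊎_; inj₁; inj₂)
open import Data.Bool using (if_then_else_)
open import Function using (_∘_)
open import Relation.Nullary using (¬_; Dec; yes; no; contradiction)
open import Relation.Nullary.Decidable using (⌊_⌋)
open import Relation.Binary using (_Preserves_⟶_)
open import Relation.Binary.PropositionalEquality

StepMonotone : (ℕ → ℕ) → Set
StepMonotone g = ∀ k → g k ≤ g (suc k)

module _ {g : ℕ → ℕ} (g↑ : StepMonotone g) where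

  monotone : g Preserves _≤_ ⟶ _≤_
  monotone = go ∘ ≤⇒≤′
    where
    go : ∀ {k k′} → k ≤′ k′ → g k ≤ g k′
    go (ℕ.≤′-reflexive refl) = ≤-refl
    go (ℕ.≤′-step k≤′k′)     = ≤-trans (go k≤′k′) (g↑ _)

  squeeze : ∀ {x y z} → x ≤ y → y ≤ z → g x ≡ g z → g y ≡ g x
  squeeze x≤y y≤z gx≡gz = ≤-antisym (≤-trans (monotone y≤z) (≤-reflexive (sym gx≡gz))) (monotone x≤y)

  plateau-or-rise : ∀ R i → (∃[ b ] b + R ≤ i * R × g b ≡ g (b + R)) ⊎ i ≤ g (i * R)
  plateau-or-rise R zero = inj₂ z≤n
  plateau-or-rise R (suc i) with plateau-or-rise R i
  ... | inj₁ (b , b+R≤iR , flat) = inj₁ (b , ≤-trans b+R≤iR (m≤n+m (i * R) R) , flat)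
  ... | inj₂ i≤g with g (i * R) ≟ g (i * R + R)
  ...   | yes flat = inj₁ (i * R , ≤-reflexive (+-comm (i * R) R) , flat)
  ...   | no rises = inj₂ (subst (λ x → suc i ≤ g x) (+-comm (i * R) R)
                        (≤-trans (s≤s i≤g) (≤∧≢⇒< (monotone (m≤m+n (i * R) R)) rises)))

  -- pigeonhole: g climbs at most d times along the d + 1 blocks of length R
  plateau : ∀ d R → g (suc d * R) ≤ d → ∃[ b ] b + R ≤ suc d * R × g b ≡ g (b + R)
  plateau d R g≤d with plateau-or-rise R (suc d)
  ... | inj₁ found = found
  ... | inj₂ d<g   = contradiction g≤d (<⇒≱ d<g)

  climb : ∀ {c} → (∀ i → suc i ≤ c → g i ≡ g (suc i) → g i ≡ c) → ∀ i → i ≤ c → i ≤ g i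
  climb stall zero    _   = z≤n
  climb stall (suc i) i<c with g i ≟ g (suc i)
  ... | yes flat = subst (suc i ≤_) (trans (sym (stall i i<c flat)) flat) i<c
  ... | no rises = ≤-trans (s≤s (climb stall i (<⇒≤ i<c))) (≤∧≢⇒< (g↑ i) rises)

  descend : ∀ {c m} → (∀ i → suc i ≤ m → g i ≡ g (suc i) → g i ≡ c) → g m ≤ c + m → g 0 ≤ c
  descend {c} {m} stall g≤ = subst (g 0 ≤_) (+-identityʳ c) (go m 0 refl)
    where
    go : ∀ r i → i + r ≡ m → g i ≤ c + i
    go zero    i i≡m = subst (λ x → g x ≤ c + x) (trans (sym i≡m) (+-identityʳ i)) g≤
    go (suc r) i i+r≡m with g i ≟ g (suc i)
    ... | yes flat = ≤-trans (≤-reflexive (stall i i<m flat)) (m≤m+n c i)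
      where i<m = subst (suc i ≤_) i+r≡m (subst (suc i ≤_) (sym (+-suc i r)) (m≤m+n (suc i) r))
    ... | no rises = ≤-pred (≤-trans (≤∧≢⇒< (g↑ i) rises)
                       (subst (g (suc i) ≤_) (+-suc c i) (go r (suc i) (trans (sym (+-suc i r)) i+r≡m))))

lcmSeq-least : ∀ {s} {a : Fin s → ℕ} {x} → (∀ i → a i ∣ x) → lcmSeq a ∣ x
lcmSeq-least {zero}  {x = x} _   = 1∣ x
lcmSeq-least {suc s}         a∣x = lcm-least (a∣x F.zero) (lcmSeq-least (a∣x ∘ F.suc))

∣lcmSeq : ∀ {s} (a : Fin s → ℕ) i → a i ∣ lcmSeq a
∣lcmSeq a F.zero    = m∣lcm[m,n] _ _
∣lcmSeq a (F.suc i) = ∣-trans (∣lcmSeq (a ∘ F.suc) i) (n∣lcm[m,n] (a F.zero) _)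

lcm-pos : ∀ {m n} → 0 < m → 0 < n → 0 < lcm m n
lcm-pos {m} {n} 0<m 0<n = n≢0⇒n>0 λ lcm≡0 → <⇒≢ (*-mono-< 0<m 0<n) (begin
    0                   ≡⟨ sym (*-zeroʳ (gcd m n)) ⟩
    gcd m n * 0         ≡⟨ cong (gcd m n *_) (sym lcm≡0) ⟩
    gcd m n * lcm m n   ≡⟨ gcd*lcm m n ⟩
    m * n               ∎)
  where open ≡-Reasoning

lcmSeq-pos : ∀ {s} (a : Fin s → ℕ) → (∀ i → 1 ≤ a i) → 1 ≤ lcmSeq a
lcmSeq-pos {zero}  a _   = ≤-refl
lcmSeq-pos {suc s} a a≥1 = lcm-pos (a≥1 F.zero) (lcmSeq-pos (a ∘ F.suc) (a≥1 ∘ F.suc))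

∣⊖∣≡∣-∣ : ∀ m n → ℤ.∣ m ⊖ n ∣ ≡ ∣ m - n ∣
∣⊖∣≡∣-∣ zero    zero    = refl
∣⊖∣≡∣-∣ zero    (suc n) = refl
∣⊖∣≡∣-∣ (suc m) zero    = refl
∣⊖∣≡∣-∣ (suc m) (suc n) = trans (cong ℤ.∣_∣ (ℤP.[1+m]⊖[1+n]≡m⊖n m n)) (∣⊖∣≡∣-∣ m n)

common-offset⇒∣∣-∣ : ∀ {x y m} {w z z′ : ℤ} →
  + x ≡ w ℤ.+ + m ℤ.* z → + y ≡ w ℤ.+ + m ℤ.* z′ → m ∣ ∣ x - y ∣
common-offset⇒∣∣-∣ {x} {y} {m} {w} {z} {z′} x≡ y≡ =
  subst (m ∣_) (sym distance) (m∣m*n ℤ.∣ z ℤ.- z′ ∣)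
  where
  open ≡-Reasoning
  cancel : ∀ (w m z z′ : ℤ) → (w ℤ.+ m ℤ.* z) ℤ.- (w ℤ.+ m ℤ.* z′) ≡ m ℤ.* (z ℤ.- z′)
  cancel = ℤ-Ring.solve-∀
  distance : ∣ x - y ∣ ≡ m * ℤ.∣ z ℤ.- z′ ∣
  distance = begin
    ∣ x - y ∣                         ≡⟨ sym (∣⊖∣≡∣-∣ x y) ⟩
    ℤ.∣ x ⊖ y ∣                       ≡⟨ cong ℤ.∣_∣ (sym (ℤP.[+m]-[+n]≡m⊖n x y)) ⟩
    ℤ.∣ + x ℤ.- + y ∣                 ≡⟨ cong ℤ.∣_∣ (trans (cong₂ ℤ._-_ x≡ y≡) (cancel w (+ m) z z′)) ⟩
    ℤ.∣ + m ℤ.* (z ℤ.- z′) ∣          ≡⟨ ℤP.abs-* (+ m) (z ℤ.- z′) ⟩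
    m * ℤ.∣ z ℤ.- z′ ∣                ∎

∣∣m-n∣⇒m≡n : ∀ {m n o} → m < o → n < o → o ∣ ∣ m - n ∣ → m ≡ n
∣∣m-n∣⇒m≡n {m} {n} m<o n<o o∣ =
  ∣m-n∣≡0⇒m≡n (small-multiple (≤-<-trans (∣m-n∣≤m⊔n m n) (⊔-lub m<o n<o)) o∣)
  where
  small-multiple : ∀ {k o} → k < o → o ∣ k → k ≡ 0
  small-multiple {zero}  _   _  = refl
  small-multiple {suc k} k<o o∣ = contradiction o∣ (>⇒∤ k<o)

module _ (s : ℕ) .{{_ : NonZero s}} where

  residues-cover% : ∀ k {r} → r < s → ∃[ t ] t < s × (k + t) % s ≡ r
  residues-cover% zero    r<s = _ , r<s , m<n⇒m%n≡m r<s
  residues-cover% (suc k) {r} r<s with residues-cover% k r<s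
  ... | suc t , t<s , k+t≡r = t , <-trans (n<1+n t) t<s , trans (cong (_% s) (sym (+-suc k t))) k+t≡r
  ... | zero  , _   , k≡r   = pred s , subst (pred s <_) (suc-pred s) (n<1+n (pred s)) , (begin
      suc (k + pred s) % s   ≡⟨ cong (_% s) (trans (sym (+-suc k (pred s))) (cong (_+_ k) (suc-pred s))) ⟩
      (k + s) % s            ≡⟨ [m+n]%n≡m%n k s ⟩
      k % s                  ≡⟨ cong (_% s) (sym (+-identityʳ k)) ⟩
      (k + 0) % s            ≡⟨ k≡r ⟩
      r                      ∎)
    where open ≡-Reasoning

  residues-cover : ∀ k (i : Fin s) → ∃[ t ] t < s × (k + t) mod s ≡ i
  residues-cover k i with residues-cover% k (toℕ<n i)
  ... | t , t<s , k+t≡i = t , t<s , toℕ-injective (trans (toℕ-fromℕ< _) k+t≡i)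

sumFin≡sum : ∀ {m} (X : Fin m → ℤ) → sumFin X ≡ sum X
sumFin≡sum {zero}  X = refl
sumFin≡sum {suc m} X = cong (ℤ._+_ (X F.zero)) (sumFin≡sum (X ∘ F.suc))

sumBelow : ℕ → (ℕ → ℤ) → ℤ
sumBelow m G = sum {m} (G ∘ toℕ)

sumBelow-last : ∀ m G → sumBelow (suc m) G ≡ sumBelow m G ℤ.+ G m
sumBelow-last m G = trans (sum-init-last {m} (G ∘ toℕ))
  (cong₂ ℤ._+_ (sum-cong-≗ {m} (cong G ∘ toℕ-inject₁)) (cong G (toℕ-fromℕ m)))

sumBelow-zero : ∀ {m} G → (∀ i → i < m → G i ≡ + 0) → sumBelow m G ≡ + 0
sumBelow-zero {zero}  G _   = refl
sumBelow-zero {suc m} G G≡0 =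
  cong₂ ℤ._+_ (G≡0 0 z<s) (sumBelow-zero {m} (G ∘ suc) (λ i i<m → G≡0 (suc i) (s<s i<m)))

sumBelow-single : ∀ {m t} G → t < m → (∀ i → i ≢ t → G i ≡ + 0) → sumBelow m G ≡ G t
sumBelow-single {suc m} {zero}  G _ G≡0 =
  trans (cong (ℤ._+_ (G 0)) (sumBelow-zero {m} (G ∘ suc) (λ i _ → G≡0 (suc i) λ ()))) (ℤP.+-identityʳ (G 0))
sumBelow-single {suc m} {suc t} G (s<s t<m) G≡0 =
  trans (cong₂ ℤ._+_ (G≡0 0 λ ())
               (sumBelow-single (G ∘ suc) t<m (λ i i≢t → G≡0 (suc i) (i≢t ∘ suc-injective))))
        (ℤP.+-identityˡ (G (suc t)))

-- divisors and scripts are read on ℕ-indices, zero beyond the last vertex, so that the path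
-- neighbours of i are simply i ∸ 1 and suc i
extend : ∀ {m} → (Fin m → ℤ) → ℕ → ℤ
extend {zero}  X i       = + 0
extend {suc m} X zero    = X F.zero
extend {suc m} X (suc i) = extend (X ∘ F.suc) i

extend-toℕ : ∀ {m} (X : Fin m → ℤ) u → extend X (toℕ u) ≡ X u
extend-toℕ X F.zero    = refl
extend-toℕ X (F.suc u) = extend-toℕ (X ∘ F.suc) u

extend-fromℕ< : ∀ {m} (X : Fin m → ℤ) {i} (i<m : i < m) → extend X i ≡ X (fromℕ< i<m)
extend-fromℕ< X i<m = trans (cong (extend X) (sym (toℕ-fromℕ< i<m))) (extend-toℕ X _)

extend-tabulate : ∀ {m} (G : ℕ → ℤ) {i} → i < m → extend {m} (G ∘ toℕ) i ≡ G i
extend-tabulate G i<m = trans (extend-fromℕ< _ i<m) (cong G (toℕ-fromℕ< i<m))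

extend-beyond : ∀ {m} (X : Fin m → ℤ) {i} → m ≤ i → extend X i ≡ + 0
extend-beyond {zero}  X _           = refl
extend-beyond {suc m} X (s≤s m≤i) = extend-beyond (X ∘ F.suc) m≤i

extend-≗ : ∀ {m} {X Y : Fin m → ℤ} → (∀ u → X u ≡ Y u) → ∀ i → extend X i ≡ extend Y i
extend-≗ {zero}  X≗Y i       = refl
extend-≗ {suc m} X≗Y zero    = X≗Y F.zero
extend-≗ {suc m} X≗Y (suc i) = extend-≗ (X≗Y ∘ F.suc) i

extend-+ : ∀ {m} (X Y : Fin m → ℤ) i → extend (λ u → X u ℤ.+ Y u) i ≡ extend X i ℤ.+ extend Y i
extend-+ {zero}  X Y i       = refl
extend-+ {suc m} X Y zero    = refl
extend-+ {suc m} X Y (suc i) = extend-+ (X ∘ F.suc) (Y ∘ F.suc) i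

extend-nonneg : ∀ {m} {X : Fin m → ℤ} → Effective X → ∀ i → + 0 ℤ.≤ extend X i
extend-nonneg {zero}  X≥0 i       = ℤP.≤-refl
extend-nonneg {suc m} X≥0 zero    = X≥0 F.zero
extend-nonneg {suc m} X≥0 (suc i) = extend-nonneg (X≥0 ∘ F.suc) i

prefix : ∀ {m} → (Fin m → ℤ) → ℕ → ℤ
prefix X k = sumBelow (suc k) (extend X)

deg≡prefix : ∀ {n} (X : Divisor (suc n)) → deg X ≡ prefix X n
deg≡prefix X = trans (sumFin≡sum X) (sum-cong-≗ (sym ∘ extend-toℕ X))

prefix-suc : ∀ {m} (X : Fin m → ℤ) k → prefix X (suc k) ≡ prefix X k ℤ.+ extend X (suc k)
prefix-suc X k = sumBelow-last (suc k) (extend X)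

prefix-≗ : ∀ {m} {X Y : Fin m → ℤ} → (∀ u → X u ≡ Y u) → ∀ k → prefix X k ≡ prefix Y k
prefix-≗ X≗Y k = sum-cong-≗ {suc k} (extend-≗ X≗Y ∘ toℕ)

prefix-+ : ∀ {m} (X Y : Fin m → ℤ) k → prefix (λ u → X u ℤ.+ Y u) k ≡ prefix X k ℤ.+ prefix Y k
prefix-+ X Y k =
  trans (sum-cong-≗ {suc k} (extend-+ X Y ∘ toℕ)) (∑-distrib-+ {suc k} (extend X ∘ toℕ) (extend Y ∘ toℕ))

prefix-injective : ∀ {n} {X Y : Divisor (suc n)} →
  (∀ k → k ≤ n → prefix X k ≡ prefix Y k) → ∀ u → X u ≡ Y u
prefix-injective {n} {X} {Y} X≡Y u =
  trans (sym (extend-toℕ X u)) (trans (extend-agree (toℕ u) (toℕ≤pred[n] u)) (extend-toℕ Y u))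
  where
  extend-agree : ∀ i → i ≤ n → extend X i ≡ extend Y i
  extend-agree zero    _   = trans (sym (ℤP.+-identityʳ _)) (trans (X≡Y 0 z≤n) (ℤP.+-identityʳ _))
  extend-agree (suc i) i<n = ∙-cancelˡ (prefix X i) _ _ (begin
    prefix X i ℤ.+ extend X (suc i)   ≡⟨ sym (prefix-suc X i) ⟩
    prefix X (suc i)                  ≡⟨ X≡Y (suc i) i<n ⟩
    prefix Y (suc i)                  ≡⟨ prefix-suc Y i ⟩
    prefix Y i ℤ.+ extend Y (suc i)   ≡⟨ cong (ℤ._+ extend Y (suc i)) (sym (X≡Y i (<⇒≤ i<n))) ⟩
    prefix X i ℤ.+ extend Y (suc i)   ∎)
    where open ≡-Reasoning

prefixℕ : ∀ {m} → (Fin m → ℤ) → ℕ → ℕ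
prefixℕ X k = ℤ.∣ prefix X k ∣

module _ {m} {X : Fin m → ℤ} (X≥0 : Effective X) where

  prefix-step : ∀ k → prefix X k ℤ.≤ prefix X (suc k)
  prefix-step k = subst₂ ℤ._≤_ (ℤP.+-identityʳ (prefix X k)) (sym (prefix-suc X k))
                    (ℤP.+-monoʳ-≤ (prefix X k) (extend-nonneg X≥0 (suc k)))

  prefix-nonneg : ∀ k → + 0 ℤ.≤ prefix X k
  prefix-nonneg zero    = subst (+ 0 ℤ.≤_) (sym (ℤP.+-identityʳ _)) (extend-nonneg X≥0 0)
  prefix-nonneg (suc k) = ℤP.≤-trans (prefix-nonneg k) (prefix-step k)

  +prefixℕ : ∀ k → + prefixℕ X k ≡ prefix X k
  +prefixℕ k = ℤP.0≤i⇒+∣i∣≡i (prefix-nonneg k)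

  prefixℕ-stepMonotone : StepMonotone (prefixℕ X)
  prefixℕ-stepMonotone k =
    ℤP.drop‿+≤+ (subst₂ ℤ._≤_ (sym (+prefixℕ k)) (sym (+prefixℕ (suc k))) (prefix-step k))

  prefixℕ-jump : ∀ {i} (v : Fin m) → toℕ v ≡ suc i → + 0 ℤ.< X v → prefixℕ X i < prefixℕ X (suc i)
  prefixℕ-jump {i} v v≡1+i 0<Xv =
    ℤP.drop‿+<+ (subst₂ ℤ._<_ (sym (+prefixℕ i)) (sym (+prefixℕ (suc i))) (begin-strict
    prefix X i                       ≡⟨ sym (ℤP.+-identityʳ _) ⟩
    prefix X i ℤ.+ + 0               <⟨ ℤP.+-monoʳ-< (prefix X i) 0<Xv ⟩
    prefix X i ℤ.+ X v               ≡⟨ cong (ℤ._+_ (prefix X i)) (trans (sym (extend-toℕ X v)) (cong (extend X) v≡1+i)) ⟩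
    prefix X i ℤ.+ extend X (suc i)  ≡⟨ sym (prefix-suc X i) ⟩
    prefix X (suc i)                 ∎))
    where open ℤP.≤-Reasoning

if-yes : ∀ {p} {P : Set p} {A : Set} (P? : Dec P) {x y : A} → P → (if ⌊ P? ⌋ then x else y) ≡ x
if-yes (yes _) _  = refl
if-yes (no ¬p) p = contradiction p ¬p

if-no : ∀ {p} {P : Set p} {A : Set} (P? : Dec P) {x y : A} → ¬ P → (if ⌊ P? ⌋ then x else y) ≡ y
if-no (yes p) ¬p = contradiction p ¬p
if-no (no _)  _  = refl

unit-self : ∀ {m} (v : Fin m) → unit v v ≡ + 1
unit-self v = if-yes (v F.≟ v) refl

unit-≢ : ∀ {m} {v u : Fin m} → v ≢ u → unit v u ≡ + 0
unit-≢ {v = v} {u} = if-no (v F.≟ u)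

unit-nonneg : ∀ {m} (v : Fin m) → Effective (unit v)
unit-nonneg v u with v F.≟ u
... | yes _ = ℤ.+≤+ z≤n
... | no _  = ℤ.+≤+ z≤n

chips : ∀ {m} → ℤ → Fin m → Divisor m
chips x v u = x ℤ.* unit v u

chips-effective : ∀ {m} k (v : Fin m) → Effective (chips (+ k) v)
chips-effective k v u with unit v u | unit-nonneg v u
... | _ | ℤ.+≤+ {n = l} _ = subst (+ 0 ℤ.≤_) (ℤP.pos-* k l) (ℤ.+≤+ z≤n)

extend-chips-off : ∀ {m} x (v : Fin m) {i} → i ≢ toℕ v → extend (chips x v) i ≡ + 0
extend-chips-off {m} x v {i} i≢v with i <? m
... | yes i<m = trans (extend-fromℕ< _ i<m) (trans (cong (ℤ._*_ x) (unit-≢ v≢)) (ℤP.*-zeroʳ x))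
  where
  v≢ : v ≢ fromℕ< i<m
  v≢ v≡ = i≢v (trans (sym (toℕ-fromℕ< i<m)) (cong toℕ (sym v≡)))
... | no i≮m  = extend-beyond _ (≮⇒≥ i≮m)

module _ {m} (x : ℤ) (v : Fin m) {k : ℕ} where

  prefix-chips-≥ : toℕ v ≤ k → prefix (chips x v) k ≡ x
  prefix-chips-≥ v≤k = begin
    prefix (chips x v) k       ≡⟨ sumBelow-single (extend (chips x v)) (s≤s v≤k) (λ _ → extend-chips-off x v) ⟩
    extend (chips x v) (toℕ v) ≡⟨ extend-toℕ (chips x v) v ⟩
    x ℤ.* unit v v             ≡⟨ cong (ℤ._*_ x) (unit-self v) ⟩
    x ℤ.* + 1                  ≡⟨ ℤP.*-identityʳ x ⟩
    x                          ∎
    where open ≡-Reasoning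

  prefix-chips-< : k < toℕ v → prefix (chips x v) k ≡ + 0
  prefix-chips-< k<v = sumBelow-zero (extend (chips x v))
    (λ i i≤k → extend-chips-off x v (λ i≡v → <⇒≱ k<v (subst (_≤ k) i≡v (≤-pred i≤k))))

deg-chips : ∀ {n} x (v : Fin (suc n)) → deg (chips x v) ≡ x
deg-chips x v = trans (deg≡prefix (chips x v)) (prefix-chips-≥ x v (toℕ≤pred[n] v))

∼-refl : ∀ {m} (w : Multigraph m) (D : Divisor m) → D ∼[ w ] D
∼-refl {m} w D = (λ _ → + 0) , λ v → sym (trans (cong (ℤ._+_ (D v)) (fire-0 v)) (ℤP.+-identityʳ (D v)))
  where
  fire-0 : ∀ v → fire w (λ _ → + 0) v ≡ + 0
  fire-0 v = trans (sumFin≡sum (λ u → + w v u ℤ.* (+ 0 ℤ.- + 0)))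
    (trans (sum-cong-≗ {m} (λ u → ℤP.*-zeroʳ (+ w v u))) (sum-replicate-zero m))

module _ {m} {w : Multigraph m} where

  ∼-subtract : ∀ {D D′ : Divisor m} → D ∼[ w ] D′ →
    ∀ (X : Divisor m) → (λ u → D u ℤ.- X u) ∼[ w ] (λ u → D′ u ℤ.- X u)
  ∼-subtract {D} (f , D′≡) X = f , λ u → trans (cong (ℤ._- X u) (D′≡ u)) (swap (D u) (fire w f u) (X u))
    where
    swap : ∀ (x y z : ℤ) → x ℤ.+ y ℤ.- z ≡ x ℤ.- z ℤ.+ y
    swap = ℤ-Ring.solve-∀

  ∼-add-back : ∀ {D E X : Divisor m} → (λ u → D u ℤ.- X u) ∼[ w ] E → D ∼[ w ] (λ u → E u ℤ.+ X u)
  ∼-add-back {D} {E} {X} (f , E≡) = f , λ u → trans (cong (ℤ._+ X u) (E≡ u)) (cancel (D u) (X u) (fire w f u))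
    where
    cancel : ∀ (x y z : ℤ) → x ℤ.- y ℤ.+ z ℤ.+ y ≡ x ℤ.+ z
    cancel = ℤ-Ring.solve-∀

pathWeight : (ℕ → ℕ) → ℕ → ℕ → ℕ
pathWeight c i j = if ⌊ j ≟ suc i ⌋ then c i else (if ⌊ i ≟ suc j ⌋ then c j else 0)

pathGraph : (ℕ → ℕ) → (n : ℕ) → Multigraph (suc n)
pathGraph c n u v = pathWeight c (toℕ u) (toℕ v)

pathWeight-split : ∀ c i j (x : ℤ) → + pathWeight c i j ℤ.* x
  ≡ (if ⌊ j ≟ suc i ⌋ then + c i ℤ.* x else + 0) ℤ.+ (if ⌊ i ≟ suc j ⌋ then + c j ℤ.* x else + 0)
pathWeight-split c i j x with j ≟ suc i | i ≟ suc j
... | yes refl | yes i≡2+i = contradiction i≡2+i (<⇒≢ (m<n⇒m<1+n (n<1+n i)))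
... | yes _    | no _      = sym (ℤP.+-identityʳ _)
... | no _     | yes _     = sym (ℤP.+-identityˡ _)
... | no _     | no _      = ℤP.*-zeroˡ x

module PathFiring (c : ℕ → ℕ) where

  -- flow F k: the chips that the script F moves from v_{k+1} to v_k
  flow : (ℕ → ℤ) → ℕ → ℤ
  flow F k = + c k ℤ.* (F (suc k) ℤ.- F k)

  leftGain : (ℕ → ℤ) → ℕ → ℤ
  leftGain F zero    = + 0
  leftGain F (suc k) = ℤ.- flow F k

  module _ {n : ℕ} (f : Fin (suc n) → ℤ) where

    private
      F = extend f

      towardsRight towardsLeft : ℕ → ℕ → ℤ
      towardsRight i j = if ⌊ j ≟ suc i ⌋ then + c i ℤ.* (F j ℤ.- F i) else + 0
      towardsLeft  i j = if ⌊ i ≟ suc j ⌋ then + c j ℤ.* (F j ℤ.- F i) else + 0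

      fire-sum : ∀ {i} → i ≤ n →
        extend (fire (pathGraph c n) f) i ≡ sumBelow (suc n) (λ j → + pathWeight c i j ℤ.* (F j ℤ.- F i))
      fire-sum {i} i≤n = begin
        extend (fire (pathGraph c n) f) i
          ≡⟨ extend-fromℕ< _ i<1+n ⟩
        fire (pathGraph c n) f v
          ≡⟨ sumFin≡sum (λ u → + pathWeight c (toℕ v) (toℕ u) ℤ.* (f u ℤ.- f v)) ⟩
        sum (λ u → + pathWeight c (toℕ v) (toℕ u) ℤ.* (f u ℤ.- f v))
          ≡⟨ sum-cong-≗ {suc n} (λ u → cong₂ (λ k x → + pathWeight c k (toℕ u) ℤ.* x) (toℕ-fromℕ< i<1+n)
                             (cong₂ ℤ._-_ (sym (extend-toℕ f u)) (sym (extend-fromℕ< f i<1+n)))) ⟩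
        sumBelow (suc n) (λ j → + pathWeight c i j ℤ.* (F j ℤ.- F i))  ∎
        where
        open ≡-Reasoning
        i<1+n = s≤s i≤n
        v = fromℕ< i<1+n

      sum-towardsLeft : ∀ i → i ≤ n → sumBelow (suc n) (towardsLeft i) ≡ leftGain F i
      sum-towardsLeft zero    _   = sumBelow-zero {suc n} (towardsLeft 0) (λ _ _ → refl)
      sum-towardsLeft (suc k) k<n = begin
        sumBelow (suc n) (towardsLeft (suc k))
          ≡⟨ sumBelow-single (towardsLeft (suc k)) (m<n⇒m<1+n k<n)
               (λ j j≢k → if-no (suc k ≟ suc j) (j≢k ∘ sym ∘ suc-injective)) ⟩
        towardsLeft (suc k) k
          ≡⟨ if-yes (suc k ≟ suc k) refl ⟩
        + c k ℤ.* (F k ℤ.- F (suc k))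
          ≡⟨ reverse (+ c k) (F k) (F (suc k)) ⟩
        leftGain F (suc k)  ∎
        where
        open ≡-Reasoning
        reverse : ∀ (w x y : ℤ) → w ℤ.* (x ℤ.- y) ≡ ℤ.- (w ℤ.* (y ℤ.- x))
        reverse = ℤ-Ring.solve-∀

      fire-split : ∀ {i} → i ≤ n →
        extend (fire (pathGraph c n) f) i ≡ sumBelow (suc n) (towardsRight i) ℤ.+ leftGain F i
      fire-split {i} i≤n = begin
        extend (fire (pathGraph c n) f) i
          ≡⟨ fire-sum i≤n ⟩
        sumBelow (suc n) (λ j → + pathWeight c i j ℤ.* (F j ℤ.- F i))
          ≡⟨ sum-cong-≗ {suc n} (λ u → pathWeight-split c i (toℕ u) (F (toℕ u) ℤ.- F i)) ⟩
        sumBelow (suc n) (λ j → towardsRight i j ℤ.+ towardsLeft i j)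
          ≡⟨ ∑-distrib-+ {suc n} (towardsRight i ∘ toℕ) (towardsLeft i ∘ toℕ) ⟩
        sumBelow (suc n) (towardsRight i) ℤ.+ sumBelow (suc n) (towardsLeft i)
          ≡⟨ cong (ℤ._+_ (sumBelow (suc n) (towardsRight i))) (sum-towardsLeft i i≤n) ⟩
        sumBelow (suc n) (towardsRight i) ℤ.+ leftGain F i  ∎
        where open ≡-Reasoning

    fire-inner : ∀ {i} → i < n → extend (fire (pathGraph c n) f) i ≡ flow F i ℤ.+ leftGain F i
    fire-inner {i} i<n = trans (fire-split (<⇒≤ i<n)) (cong (ℤ._+ leftGain F i)
      (trans (sumBelow-single (towardsRight i) (s<s i<n) (λ j j≢1+i → if-no (j ≟ suc i) j≢1+i))
             (if-yes (suc i ≟ suc i) refl)))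

    fire-last : extend (fire (pathGraph c n) f) n ≡ leftGain F n
    fire-last = trans (fire-split ≤-refl) (trans (cong (ℤ._+ leftGain F n)
      (sumBelow-zero {suc n} (towardsRight n) (λ j j<1+n → if-no (j ≟ suc n) (<⇒≢ j<1+n)))) (ℤP.+-identityˡ _))

    -- the chips fired into {v₀, …, vₖ} all cross the edge vₖ vₖ₊₁
    prefix-fire : ∀ k → k < n → prefix (fire (pathGraph c n) f) k ≡ flow F k
    prefix-fire zero    0<n = trans (ℤP.+-identityʳ _) (trans (fire-inner 0<n) (ℤP.+-identityʳ _))
    prefix-fire (suc k) k<n = begin
      prefix (fire (pathGraph c n) f) (suc k)
        ≡⟨ prefix-suc (fire (pathGraph c n) f) k ⟩
      prefix (fire (pathGraph c n) f) k ℤ.+ extend (fire (pathGraph c n) f) (suc k)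
        ≡⟨ cong₂ ℤ._+_ (prefix-fire k (<-trans (n<1+n k) k<n)) (fire-inner k<n) ⟩
      flow F k ℤ.+ (flow F (suc k) ℤ.- flow F k)
        ≡⟨ cancel (flow F k) (flow F (suc k)) ⟩
      flow F (suc k)  ∎
      where
      open ≡-Reasoning
      cancel : ∀ (x y : ℤ) → x ℤ.+ (y ℤ.- x) ≡ y
      cancel = ℤ-Ring.solve-∀

  prefix-fire-last : ∀ {n} (f : Fin (suc n) → ℤ) → prefix (fire (pathGraph c n) f) n ≡ + 0
  prefix-fire-last {zero}  f = trans (ℤP.+-identityʳ _) (fire-last f)
  prefix-fire-last {suc n} f = begin
    prefix (fire (pathGraph c (suc n)) f) (suc n)
      ≡⟨ prefix-suc (fire (pathGraph c (suc n)) f) n ⟩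
    prefix (fire (pathGraph c (suc n)) f) n ℤ.+ extend (fire (pathGraph c (suc n)) f) (suc n)
      ≡⟨ cong₂ ℤ._+_ (prefix-fire f n (n<1+n n)) (fire-last f) ⟩
    flow (extend f) n ℤ.- flow (extend f) n
      ≡⟨ ℤP.+-inverseʳ (flow (extend f) n) ⟩
    + 0  ∎
    where open ≡-Reasoning

  module _ {n : ℕ} (D : Divisor (suc n)) (f : Fin (suc n) → ℤ) where

    prefix-+fire : ∀ k → k < n →
      prefix (λ u → D u ℤ.+ fire (pathGraph c n) f u) k ≡ prefix D k ℤ.+ flow (extend f) k
    prefix-+fire k k<n = trans (prefix-+ D (fire (pathGraph c n) f) k) (cong (ℤ._+_ (prefix D k)) (prefix-fire f k k<n))

    prefix-+fire-last : prefix (λ u → D u ℤ.+ fire (pathGraph c n) f u) n ≡ prefix D n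
    prefix-+fire-last = trans (prefix-+ D (fire (pathGraph c n) f) n)
      (trans (cong (ℤ._+_ (prefix D n)) (prefix-fire-last f)) (ℤP.+-identityʳ (prefix D n)))

  module _ {n : ℕ} {D D′ : Divisor (suc n)} where

    ∼-prefix : D ∼[ pathGraph c n ] D′ → ∀ k → k < n → ∃[ z ] prefix D′ k ≡ prefix D k ℤ.+ + c k ℤ.* z
    ∼-prefix (f , D′≡) k k<n = extend f (suc k) ℤ.- extend f k , trans (prefix-≗ D′≡ k) (prefix-+fire D f k k<n)

    ∼-prefix-last : D ∼[ pathGraph c n ] D′ → prefix D′ n ≡ prefix D n
    ∼-prefix-last (f , D′≡) = trans (prefix-≗ D′≡ n) (prefix-+fire-last D f)

    prefix-∼ : (z : ℕ → ℤ) → (∀ k → k < n → prefix D′ k ≡ prefix D k ℤ.+ + c k ℤ.* z k) →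
               prefix D′ n ≡ prefix D n → D ∼[ pathGraph c n ] D′
    prefix-∼ z D′≡ D′≡-last = f , prefix-injective agree
      where
      f : Fin (suc n) → ℤ
      f u = sumBelow (toℕ u) z
      flow-f : ∀ k → k < n → flow (extend f) k ≡ + c k ℤ.* z k
      flow-f k k<n = cong (ℤ._*_ (+ c k)) (begin
        extend f (suc k) ℤ.- extend f k
          ≡⟨ cong₂ ℤ._-_ (extend-tabulate (λ i → sumBelow i z) (s<s k<n))
                         (extend-tabulate (λ i → sumBelow i z) (m<n⇒m<1+n k<n)) ⟩
        sumBelow (suc k) z ℤ.- sumBelow k z
          ≡⟨ cong (ℤ._- sumBelow k z) (sumBelow-last k z) ⟩
        sumBelow k z ℤ.+ z k ℤ.- sumBelow k z
          ≡⟨ cancel (sumBelow k z) (z k) ⟩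
        z k  ∎)
        where
        open ≡-Reasoning
        cancel : ∀ (x y : ℤ) → x ℤ.+ y ℤ.- x ≡ y
        cancel = ℤ-Ring.solve-∀
      agree : ∀ k → k ≤ n → prefix D′ k ≡ prefix (λ u → D u ℤ.+ fire (pathGraph c n) f u) k
      agree k k≤n with m≤n⇒m<n∨m≡n k≤n
      ... | inj₁ k<n  =
        trans (D′≡ k k<n) (sym (trans (prefix-+fire D f k k<n) (cong (ℤ._+_ (prefix D k)) (flow-f k k<n))))
      ... | inj₂ refl = trans D′≡-last (sym (prefix-+fire-last D f))

  module _ {n : ℕ} {D X Y : Divisor (suc n)} (D∼X : D ∼[ pathGraph c n ] X) (D∼Y : D ∼[ pathGraph c n ] Y)
           (X≥0 : Effective X) (Y≥0 : Effective Y) where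

    ∼-prefixℕ-last : prefixℕ Y n ≡ prefixℕ X n
    ∼-prefixℕ-last = cong ℤ.∣_∣ (trans (∼-prefix-last {D = D} {Y} D∼Y) (sym (∼-prefix-last {D = D} {X} D∼X)))

    ∼-prefixℕ-congruent : ∀ k → k ≤ n → c k ∣ ∣ prefixℕ Y k - prefixℕ X k ∣
    ∼-prefixℕ-congruent k k≤n with m≤n⇒m<n∨m≡n k≤n
    ... | inj₂ refl = subst (c n ∣_) (sym (m≡n⇒∣m-n∣≡0 ∼-prefixℕ-last)) (c n ∣0)
    ... | inj₁ k<n with ∼-prefix {D = D} {Y} D∼Y k k<n | ∼-prefix {D = D} {X} D∼X k k<n
    ...   | zY , Y≡ | zX , X≡ =
      common-offset⇒∣∣-∣ {w = prefix D k} {zY} {zX} (trans (+prefixℕ Y≥0 k) Y≡) (trans (+prefixℕ X≥0 k) X≡)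

module _ (c : ℕ → ℕ) where
  open PathFiring c

  -- every edge to the left of v has to carry L chips rightwards: a script difference of −L / c k
  chips-move : ∀ {n L} → (∀ k → c k ∣ L) → (v : Fin (suc n)) →
    chips (+ L) F.zero ∼[ pathGraph c n ] chips (+ L) v
  chips-move {n} {L} c∣L v = prefix-∼ {D = chips (+ L) F.zero} {D′ = chips (+ L) v} z moved
    (trans (prefix-chips-≥ (+ L) v (toℕ≤pred[n] v)) (sym (prefix-chips-≥ (+ L) (F.zero {n}) {n} z≤n)))
    where
    z : ℕ → ℤ
    z k = if ⌊ k <? toℕ v ⌋ then ℤ.- + quotient (c∣L k) else + 0
    moved : ∀ k → k < n → prefix (chips (+ L) v) k ≡ prefix (chips (+ L) (F.zero {n})) k ℤ.+ + c k ℤ.* z k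
    moved k _ with k <? toℕ v
    ... | yes k<v = trans (prefix-chips-< (+ L) v k<v)
                      (sym (trans (cong₂ ℤ._+_ (prefix-chips-≥ (+ L) (F.zero {n}) {k} z≤n) refl) (L-cancels (c∣L k))))
      where
      L-cancels : ∀ {m} (m∣L : m ∣ L) → + L ℤ.+ + m ℤ.* ℤ.- + quotient m∣L ≡ + 0
      L-cancels {m} (divides q L≡q*m) =
        trans (cong₂ ℤ._+_ (trans (cong +_ L≡q*m) (ℤP.pos-* q m)) refl) (cancel (+ q) (+ m))
        where
        cancel : ∀ (x y : ℤ) → x ℤ.* y ℤ.+ y ℤ.* ℤ.- x ≡ + 0
        cancel = ℤ-Ring.solve-∀
    ... | no k≮v = trans (prefix-chips-≥ (+ L) v (≮⇒≥ k≮v))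
                     (sym (trans (cong₂ ℤ._+_ (prefix-chips-≥ (+ L) (F.zero {n}) {k} z≤n) (ℤP.*-zeroʳ (+ c k)))
                                 (ℤP.+-identityʳ (+ L))))

  chips-positiveRank : ∀ {n L} → 1 ≤ L → (∀ k → c k ∣ L) → PositiveRank (pathGraph c n) (chips (+ L) F.zero)
  chips-positiveRank {n} {suc L} _ c∣L =
      (chips (+ suc L) F.zero , chips-effective (suc L) F.zero , ∼-refl (pathGraph c n) (chips (+ suc L) F.zero))
    , λ v → (λ u → chips (+ suc L) v u ℤ.- unit v u) , one-fewer v
          , ∼-subtract {w = pathGraph c n} {D = chips (+ suc L) F.zero} (chips-move c∣L v) (unit v)
    where
    one-fewer : ∀ v → Effective (λ u → chips (+ suc L) v u ℤ.- unit v u)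
    one-fewer v u = subst (+ 0 ℤ.≤_) (sym (drop-one (+ L) (unit v u))) (chips-effective L v u)
      where
      drop-one : ∀ (l x : ℤ) → (+ 1 ℤ.+ l) ℤ.* x ℤ.- x ≡ l ℤ.* x
      drop-one = ℤ-Ring.solve-∀

-- p and q are the prefix sums of E₀ and of E + v, and p is constant on the window [b, b + 1 + dσ].
module Plateau {s : ℕ} .{{_ : NonZero s}} (a : Fin s → ℕ) {p q : ℕ → ℕ}
  (p↑ : StepMonotone p) (q↑ : StepMonotone q) {d b : ℕ} (d<L : d < lcmSeq a)
  (flat : p b ≡ p (b + suc (d * pred s))) (c≤d : p b ≤ d) (q≤d : q (b + suc (d * pred s)) ≤ d)
  (congruent : ∀ k → k ≤ b + suc (d * pred s) → a (k mod s) ∣ ∣ q k - p k ∣)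
  where

  private
    σ = pred s
    c = p b
    e = b + suc (d * σ)

    shift : ∀ x i → x + i * σ + σ ≡ x + suc i * σ
    shift x i = trans (+-assoc x (i * σ) σ) (cong (_+_ x) (+-comm (i * σ) σ))

  -- q k ≡ q (k + σ) makes q constant across all s residues, so q k ≡ c modulo every a i, hence modulo L.
  stall : ∀ {k} → b ≤ k → k + σ ≤ e → q k ≡ q (k + σ) → q k ≡ c
  stall {k} b≤k k+σ≤e q-flat = ∣∣m-n∣⇒m≡n (≤-<-trans q≤ d<L) (≤-<-trans c≤d d<L) (lcmSeq-least each)
    where
    q≤ : q k ≤ d
    q≤ = ≤-trans (monotone q↑ (≤-trans (m≤m+n k σ) k+σ≤e)) q≤d
    each : ∀ i → a i ∣ ∣ q k - c ∣
    each i with residues-cover s k i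
    ... | t , t<s , k+t≡i = subst (λ j → a j ∣ ∣ q k - c ∣) k+t≡i
                              (subst₂ (λ x y → a ((k + t) mod s) ∣ ∣ x - y ∣) q-const p-const
                                 (congruent (k + t) k+t≤e))
      where
      k+t≤k+σ : k + t ≤ k + σ
      k+t≤k+σ = +-monoʳ-≤ k (<⇒≤pred t<s)
      k+t≤e : k + t ≤ e
      k+t≤e = ≤-trans k+t≤k+σ k+σ≤e
      q-const : q (k + t) ≡ q k
      q-const = squeeze q↑ (m≤m+n k t) k+t≤k+σ q-flat
      p-const : p (k + t) ≡ c
      p-const = squeeze p↑ (≤-trans b≤k (m≤m+n k t)) k+t≤e flat

  reaches-c : c ≤ q (b + c * σ)
  reaches-c = climb step↑ stall-at c ≤-refl
    where
    step↑ : StepMonotone (λ i → q (b + i * σ))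
    step↑ i = monotone q↑ (+-monoʳ-≤ b (m≤n+m (i * σ) σ))
    stall-at : ∀ i → suc i ≤ c → q (b + i * σ) ≡ q (b + suc i * σ) → q (b + i * σ) ≡ c
    stall-at i i<c q-flat = stall (m≤m+n b (i * σ)) k+σ≤e (trans q-flat (cong q (sym (shift b i))))
      where
      k+σ≤e : b + i * σ + σ ≤ e
      k+σ≤e = begin
        b + i * σ + σ     ≡⟨ shift b i ⟩
        b + suc i * σ     ≤⟨ +-monoʳ-≤ b (*-monoˡ-≤ σ (≤-trans i<c c≤d)) ⟩
        b + d * σ         <⟨ +-monoʳ-< b (n<1+n (d * σ)) ⟩
        e                 ∎
        where open ≤-Reasoning

  stays-c : q (suc (b + c * σ)) ≤ c
  stays-c = subst (λ x → q x ≤ c) (+-identityʳ j) (descend step↑ stall-at q-top)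
    where
    j = suc (b + c * σ)
    j-to-e : j + (d ∸ c) * σ ≡ e
    j-to-e = trans (cong suc (trans (+-assoc b (c * σ) ((d ∸ c) * σ))
                     (cong (_+_ b) (trans (sym (*-distribʳ-+ σ c (d ∸ c))) (cong (_* σ) (m+[n∸m]≡n c≤d))))))
                   (sym (+-suc b (d * σ)))
    step↑ : StepMonotone (λ i → q (j + i * σ))
    step↑ i = monotone q↑ (+-monoʳ-≤ j (m≤n+m (i * σ) σ))
    q-top : q (j + (d ∸ c) * σ) ≤ c + (d ∸ c)
    q-top = subst₂ (λ x y → q x ≤ y) (sym j-to-e) (sym (m+[n∸m]≡n c≤d)) q≤d
    stall-at : ∀ i → suc i ≤ d ∸ c → q (j + i * σ) ≡ q (j + suc i * σ) → q (j + i * σ) ≡ c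
    stall-at i i<m q-flat = stall b≤k k+σ≤e (trans q-flat (cong q (sym (shift j i))))
      where
      b≤k : b ≤ j + i * σ
      b≤k = ≤-trans (m≤m+n b (c * σ)) (≤-trans (n≤1+n _) (m≤m+n j (i * σ)))
      k+σ≤e : j + i * σ + σ ≤ e
      k+σ≤e = begin
        j + i * σ + σ       ≡⟨ shift j i ⟩
        j + suc i * σ       ≤⟨ +-monoʳ-≤ j (*-monoˡ-≤ σ i<m) ⟩
        j + (d ∸ c) * σ     ≡⟨ j-to-e ⟩
        e                   ∎
        where open ≤-Reasoning

  no-jump : q (suc (b + c * σ)) ≤ q (b + c * σ)
  no-jump = ≤-trans stays-c reaches-c

window-fits : ∀ {s d L} → 0 < s → d < L → suc d * suc (d * pred s) ≤ s * L ^ 2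
window-fits {suc σ} {d} {L} _ d<L = begin
  suc d * suc (d * σ)   ≤⟨ *-mono-≤ d<L (+-mono-≤ (≤-trans (s≤s z≤n) d<L) (*-monoˡ-≤ σ (<⇒≤ d<L))) ⟩
  L * (L + L * σ)       ≡⟨ rearrange L σ ⟩
  suc σ * L ^ 2         ∎
  where
  open ≤-Reasoning
  rearrange : ∀ L σ → L * (L + L * σ) ≡ (1 + σ) * (L * (L * 1))
  rearrange = ℕ-Ring.solve-∀

module _ {s : ℕ} .{{_ : NonZero s}} (a : Fin s → ℕ) {n : ℕ} where

  private
    L = lcmSeq a
    σ = pred s
    weight : ℕ → ℕ
    weight k = a (k mod s)

  -- banana s a n is, by definition, pathGraph weight n
  open PathFiring weight

  module SmallDegree {D E₀ : Divisor (suc n)} (E₀≥0 : Effective E₀) (D∼E₀ : D ∼[ banana s a n ] E₀)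
                     (n≥sL² : s * L ^ 2 ≤ n) (deg<L : deg D ℤ.< + L) where

    private
      p = prefixℕ E₀
      p↑ = prefixℕ-stepMonotone E₀≥0
      d = p n
      R = suc (d * σ)

      d<L : d < L
      d<L = ℤP.drop‿+<+ (subst (ℤ._< + L) (sym +d≡deg) deg<L)
        where
        +d≡deg : + d ≡ deg D
        +d≡deg = trans (+prefixℕ E₀≥0 n) (trans (∼-prefix-last {D = D} {E₀} D∼E₀) (sym (deg≡prefix D)))

      windows-fit : suc d * R ≤ n
      windows-fit = ≤-trans (window-fits (ℕ.>-nonZero⁻¹ s) d<L) n≥sL²

      window : ∃[ b ] b + R ≤ suc d * R × p b ≡ p (b + R)
      window = plateau p↑ d R (monotone p↑ windows-fit)

      b = proj₁ window
      c = p b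

      e≤n : b + R ≤ n
      e≤n = ≤-trans (proj₁ (proj₂ window)) windows-fit

      c≤d : c ≤ d
      c≤d = monotone p↑ (≤-trans (m≤m+n b R) e≤n)

      j′ = b + c * σ

      j′<n : suc j′ ≤ n
      j′<n = ≤-trans (s≤s (+-monoʳ-≤ b (*-monoˡ-≤ σ c≤d)))
                     (≤-trans (≤-reflexive (sym (+-suc b (d * σ)))) e≤n)

    v : Fin (suc n)
    v = fromℕ< (s≤s j′<n)

    v-unremovable : ¬ RankNonNeg (banana s a n) (λ u → D u ℤ.- unit v u)
    v-unremovable (E , E≥0 , D-v∼E) =
      <⇒≱ jump (Plateau.no-jump a p↑ q↑ d<L (proj₂ (proj₂ window)) c≤d q≤d congruent)
      where
      Y : Divisor (suc n)
      Y u = E u ℤ.+ unit v u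
      Y≥0 : Effective Y
      Y≥0 u = ℤP.+-mono-≤ (E≥0 u) (unit-nonneg v u)
      D∼Y : D ∼[ banana s a n ] Y
      D∼Y = ∼-add-back {w = banana s a n} {D = D} {X = unit v} D-v∼E
      q = prefixℕ Y
      q↑ = prefixℕ-stepMonotone Y≥0
      q≤d : q (b + R) ≤ d
      q≤d = ≤-trans (monotone q↑ e≤n) (≤-reflexive (∼-prefixℕ-last {D = D} D∼E₀ D∼Y E₀≥0 Y≥0))
      congruent : ∀ k → k ≤ b + R → weight k ∣ ∣ q k - p k ∣
      congruent k k≤e = ∼-prefixℕ-congruent {D = D} D∼E₀ D∼Y E₀≥0 Y≥0 k (≤-trans k≤e e≤n)
      jump : q j′ < q (suc j′)
      jump = prefixℕ-jump Y≥0 v (toℕ-fromℕ< (s≤s j′<n))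
               (ℤP.+-mono-≤-< (E≥0 v) (subst (+ 0 ℤ.<_) (sym (unit-self v)) (ℤ.+<+ z<s)))

  banana-gonality-≥ : s * lcmSeq a ^ 2 ≤ n → ∀ D → PositiveRank (banana s a n) D → + lcmSeq a ℤ.≤ deg D
  banana-gonality-≥ n≥sL² D ((E₀ , E₀≥0 , D∼E₀) , D-v≥0) = ℤP.≮⇒≥ λ deg<L →
    let open SmallDegree {D = D} E₀≥0 D∼E₀ n≥sL² deg<L in v-unremovable (D-v≥0 v)

corollary4p2 : (s : ℕ) → .{{_ : NonZero s}} → (a : Fin s → ℕ) → (∀ j → 1 ≤ a j)
    → (n : ℕ) → s * (lcmSeq a ^ 2) ≤ n
    → GonalityIs (banana s a n) (lcmSeq a)
corollary4p2 s a a≥1 n n≥sL² =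
    ( chips (+ lcmSeq a) F.zero
    , chips-positiveRank (λ k → a (k mod s)) (lcmSeq-pos a a≥1) (λ k → ∣lcmSeq a (k mod s))
    , deg-chips (+ lcmSeq a) (F.zero {n}) )
  , banana-gonality-≥ a n≥sL²
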